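{- Let $(\alpha_n(a,k),\beta_n(a,k))_{n\ge0}$ be a family of sequences, depending on parameters $a,k$, satisfying for all $a,k$ and all $n\ge0$ \[ \beta_{n}(a,k) = \sum_{j=0}^{n}\frac{(k/a;q)_{n-j}(k;q)_{n+j}}{(q;q)_{n-j}(aq;q)_{n+j}}\alpha_{j}(a,k). \] Let $(g_n)_{n\ge0}$ be an arbitrary sequence and $c,e$ arbitrary constants. Define \[ \alpha_n'(a,k) = g_n\alpha_n(e,c), \] \[ \beta_{n}'(a,k)= \sum_{j=0}^{n}\beta_{j}(e,c)\frac{(1-c q^{2j})(k/a;q)_{n-j}(k;q)_{n+j}(eq;q)_{2j}}{(1-c)(q;q)_{n-j}(aq;q)_{n+j}(cq;q)_{2j}} \sum_{r=0}^{n-j}\frac{(1-eq^{2j+2r})(q^{ -(n-j)},kq^{n+j},e/c,eq^{2j};q)_r}{(1-e q^{2j})(a q^{n+j+1},a q^{1-(n-j)}/k,cq^{2j+1},q;q)_r}\left(\frac{q a c}{k e} \right)^r g_{r+j}. \] Then $(\alpha_n'(a,k),\beta_n'(a,k))$ satisfies the same relation, i.e. $\beta_n'(a,k)=\sum_{j=0}^{n}\frac{(k/a;q)_{n-j}(k;q)_{n+j}}{(q;q)_{n-j}(aq;q)_{n+j}}\alpha_j'(a,k)$ for all $n\ge0$.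
   Context: $(x;q)_n=\prod_{i=0}^{n-1}(1-xq^i)$ and $(x_1,\dots,x_m;q)_n=(x_1;q)_n\cdots(x_m;q)_n$. All parameters are generic so that denominators are nonzero. -}

module Defs where

open import Level using (Level; _⊔_) renaming (suc to lsuc)
open import Algebra.Bundles using (CommutativeRing)
open import Data.Nat using (ℕ; zero; suc; _∸_; _≤_) renaming (_*_ to _*ℕ_; _+_ to _+ℕ_)
open import Relation.Nullary using (¬_)
open import Data.Product using (_×_)

record Field (c ℓ : Level) : Set (lsuc (c ⊔ ℓ)) where
  field
    commutativeRing : CommutativeRing c ℓ
  open CommutativeRing commutativeRing public
  field
    _⁻¹       : Carrier → Carrier
    ⁻¹-cong   : ∀ {x y} → x ≈ y → (x ⁻¹) ≈ (y ⁻¹)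
    ⁻¹-inverse : ∀ x → ¬ (x ≈ 0#) → (x * (x ⁻¹)) ≈ 1#
    0≉1       : ¬ (0# ≈ 1#)

module _ {c ℓ : Level} (F : Field c ℓ) where
  open Field F

  NZ : Carrier → Set ℓ
  NZ x = ¬ (x ≈ 0#)

  _−_ : Carrier → Carrier → Carrier
  x − y = x + (- y)

  _÷_ : Carrier → Carrier → Carrier
  x ÷ y = x * (y ⁻¹)

  pow : Carrier → ℕ → Carrier
  pow x zero    = 1#
  pow x (suc n) = x * pow x n

  poch : Carrier → Carrier → ℕ → Carrier
  poch x q zero    = 1#
  poch x q (suc n) = poch x q n * (1# − (x * pow q n))

  sumTo : ℕ → (ℕ → Carrier) → Carrier
  sumTo zero    f = f 0
  sumTo (suc n) f = sumTo n f + f (suc n)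

  coef : (q a k : Carrier) → ℕ → ℕ → Carrier
  coef q a k n j =
    (poch (k ÷ a) q (n ∸ j) * poch k q (n +ℕ j))
      ÷ (poch q q (n ∸ j) * poch (a * q) q (n +ℕ j))

  PairRel : (q a k : Carrier) → (α β : ℕ → Carrier) → Set ℓ
  PairRel q a k α β = ∀ n → β n ≈ sumTo n (λ j → coef q a k n j * α j)

  -- genericity for the parameters (a,k) of the basic relation:
  -- all denominators in it are nonzero
  BaseGeneric : (q a k : Carrier) → Set ℓ
  BaseGeneric q a k =
    NZ a × (∀ m → NZ (poch q q m)) × (∀ m → NZ (poch (a * q) q m))

  alpha' : (g : ℕ → Carrier) → (αec : ℕ → Carrier) → ℕ → Carrier
  alpha' g αec n = g n * αec n

  inner : (q a k c e : Carrier) → (g : ℕ → Carrier) → ℕ → ℕ → Carrier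
  inner q a k c e g n j = sumTo (n ∸ j) λ r →
    (((((1# − (e * pow q ((2 *ℕ j) +ℕ (2 *ℕ r))))
        * poch (pow (q ⁻¹) (n ∸ j)) q r)
        * poch (k * pow q (n +ℕ j)) q r)
        * poch (e ÷ c) q r)
        * poch (e * pow q (2 *ℕ j)) q r)
    ÷ (((((1# − (e * pow q (2 *ℕ j)))
        * poch (a * pow q (suc (n +ℕ j))) q r)
        * poch (((a * q) * pow (q ⁻¹) (n ∸ j)) ÷ k) q r)
        * poch (c * pow q (suc (2 *ℕ j))) q r)
        * poch q q r)
    * (pow ((q * a * c) ÷ (k * e)) r * g (r +ℕ j))

  beta' : (q a k c e : Carrier) → (g : ℕ → Carrier) → (βec : ℕ → Carrier) → ℕ → Carrier
  beta' q a k c e g βec n = sumTo n λ j →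
    (βec j
      * (((((1# − (c * pow q (2 *ℕ j))) * poch (k ÷ a) q (n ∸ j)) * poch k q (n +ℕ j))
           * poch (e * q) q (2 *ℕ j))
         ÷ ((((1# − c) * poch q q (n ∸ j)) * poch (a * q) q (n +ℕ j))
           * poch (c * q) q (2 *ℕ j))))
    * inner q a k c e g n j

  -- genericity for the data of the theorem: every denominator occurring in
  -- the definition of β'_n(a,k) (for its index ranges) is nonzero,
  -- together with q ≠ 0 (needed for q^{-1}) and c ≠ 0 (e/c).
  ExtraGeneric : (q a k c e : Carrier) → Set ℓ
  ExtraGeneric q a k c e =
    NZ q × NZ k × NZ e × NZ c × NZ (1# − c)
    × (∀ m → NZ (poch (c * q) q m))
    × (∀ j → NZ (1# − (e * pow q (2 *ℕ j))))
    × (∀ n j r → j ≤ n → r ≤ n ∸ j →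
         NZ (poch (a * pow q (suc (n +ℕ j))) q r)
         × NZ (poch (((a * q) * pow (q ⁻¹) (n ∸ j)) ÷ k) q r)
         × NZ (poch (c * pow q (suc (2 *ℕ j))) q r))

-- Write β_j(e,c) = Σ_{i≤j} M_{j,i} α_i(e,c), where M_{j,i} = coef q e c j i is the Bailey matrix. It has
-- the explicit lower-triangular inverse
--   P_{m,j} = (1 − cq^{2j})(1 − eq^{2m})(e;q)_{m+j} ∏_{i<m−j}(c/e − q^i)
--             / ((1 − c)(1 − e)(cq;q)_{m+j}(q;q)_{m−j}):
-- multiplied by (1 − eq^{m+i})(1 − q^{m−i}), the partial sums Σ_{j=i}^{J} P_{m,j} M_{j,i} have a closed form
-- containing the factor 1 − q^{m−J}, which vanishes at J = m.  By the reflection formula for q-shifted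
-- factorials, the (j, r) summand of β'_n(a,k) is coef q a k n m · P_{m,j} · g_m with m = r + j.  Exchanging
-- the order of summation over i ≤ j ≤ m ≤ n then collapses Σ_j P_{m,j} M_{j,i} to δ_{m,i} and leaves
-- Σ_m coef q a k n m · g_m α_m(e,c).

module Submission where

open import Algebra.Bundles using (CommutativeRing)
import Algebra.Solver.Ring.AlmostCommutativeRing as ACR
open import Data.Integer as ℤ using (ℤ; +_; -[1+_]; _⊖_; _◃_; 1ℤ)
import Data.Integer.Properties as ℤ
open import Data.Maybe using (Maybe; just; nothing)
open import Data.Nat as ℕ using (ℕ; zero; suc; _≤_; _<_; _∸_; z≤n) renaming (_+_ to _+ℕ_; _*_ to _*ℕ_)
import Data.Nat.Properties as ℕ
open import Data.Nat.Tactic.RingSolver using (solve-∀)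
open import Data.Product using (_×_; _,_)
open import Data.Sign as Sign using (Sign)
open import Level using (Level)
open import Relation.Binary.PropositionalEquality as ≡ using (_≡_)
open import Relation.Nullary using (yes; no)
open import Defs using (Field; BaseGeneric; PairRel; ExtraGeneric; alpha'; beta')
import Defs

-- The normaliser of Algebra.Solver.Ring cancels terms only through decidable equality of coefficients,
-- so coefficients are taken in ℤ, mapped into the ring by n ↦ n · 1#.
module IntegerCoefficientSolver {ℓ₁ ℓ₂} (R : CommutativeRing ℓ₁ ℓ₂) where
  open CommutativeRing R
  open import Algebra.Properties.Ring ring using (-‿involutive; -0#≈0#; -1*x≈-x; -‿+-comm)
  open import Algebra.Properties.Semiring.Mult.TCOptimised semiring
    using (1+×; ×-homo-+; ×1-homo-*) renaming (_×_ to _·_)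
  open import Algebra.Properties.CommutativeSemigroup *-commutativeSemigroup using (interchange)
  open import Relation.Binary.Reasoning.Setoid setoid

  ⟦_⟧ : ℤ → Carrier
  ⟦ + n ⟧      = n · 1#
  ⟦ -[1+ n ] ⟧ = - (suc n · 1#)

  ⟦_⟧ₛ : Sign → Carrier
  ⟦ Sign.+ ⟧ₛ = 1#
  ⟦ Sign.- ⟧ₛ = - 1#

  cancel-1# : ∀ a b → (1# + a) + - (1# + b) ≈ a + - b
  cancel-1# a b = begin
    (1# + a) + - (1# + b)     ≈⟨ +-congˡ (sym (-‿+-comm 1# b)) ⟩
    (1# + a) + (- 1# + - b)   ≈⟨ +-congʳ (+-comm 1# a) ⟩
    (a + 1#) + (- 1# + - b)   ≈⟨ +-assoc a 1# _ ⟩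
    a + (1# + (- 1# + - b))   ≈⟨ +-congˡ (sym (+-assoc 1# (- 1#) (- b))) ⟩
    a + ((1# + - 1#) + - b)   ≈⟨ +-congˡ (+-congʳ (-‿inverseʳ 1#)) ⟩
    a + (0# + - b)            ≈⟨ +-congˡ (+-identityˡ (- b)) ⟩
    a + - b                   ∎

  ⟦⟧-⊖ : ∀ m n → ⟦ m ⊖ n ⟧ ≈ m · 1# + - (n · 1#)
  ⟦⟧-⊖ m       zero    = sym (trans (+-congˡ -0#≈0#) (+-identityʳ _))
  ⟦⟧-⊖ zero    (suc n) = sym (+-identityˡ _)
  ⟦⟧-⊖ (suc m) (suc n) = begin
    ⟦ suc m ⊖ suc n ⟧                     ≡⟨ ≡.cong ⟦_⟧ (ℤ.[1+m]⊖[1+n]≡m⊖n m n) ⟩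
    ⟦ m ⊖ n ⟧                             ≈⟨ ⟦⟧-⊖ m n ⟩
    m · 1# + - (n · 1#)                   ≈⟨ sym (cancel-1# (m · 1#) (n · 1#)) ⟩
    (1# + m · 1#) + - (1# + n · 1#)       ≈⟨ sym (+-cong (1+× m 1#) (-‿cong (1+× n 1#))) ⟩
    suc m · 1# + - (suc n · 1#)           ∎

  ⟦⟧-◃ : ∀ s n → ⟦ s ◃ n ⟧ ≈ ⟦ s ⟧ₛ * (n · 1#)
  ⟦⟧-◃ s      zero    = sym (zeroʳ _)
  ⟦⟧-◃ Sign.+ (suc n) = sym (*-identityˡ _)
  ⟦⟧-◃ Sign.- (suc n) = sym (-1*x≈-x _)

  ⟦⟧-signAbs : ∀ i → ⟦ i ⟧ ≈ ⟦ ℤ.sign i ⟧ₛ * (ℤ.∣ i ∣ · 1#)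
  ⟦⟧-signAbs i = trans (reflexive (≡.cong ⟦_⟧ (≡.sym (ℤ.◃-inverse i)))) (⟦⟧-◃ (ℤ.sign i) ℤ.∣ i ∣)

  ⟦⟧ₛ-* : ∀ s t → ⟦ s Sign.* t ⟧ₛ ≈ ⟦ s ⟧ₛ * ⟦ t ⟧ₛ
  ⟦⟧ₛ-* Sign.+ t      = sym (*-identityˡ _)
  ⟦⟧ₛ-* Sign.- Sign.+ = sym (*-identityʳ _)
  ⟦⟧ₛ-* Sign.- Sign.- = sym (trans (-1*x≈-x _) (-‿involutive 1#))

  ⟦⟧-* : ∀ i j → ⟦ i ℤ.* j ⟧ ≈ ⟦ i ⟧ * ⟦ j ⟧
  ⟦⟧-* i j = begin
    ⟦ i ℤ.* j ⟧                                 ≈⟨ ⟦⟧-◃ (s Sign.* t) (m ℕ.* n) ⟩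
    ⟦ s Sign.* t ⟧ₛ * ((m ℕ.* n) · 1#)          ≈⟨ *-cong (⟦⟧ₛ-* s t) (×1-homo-* m n) ⟩
    (⟦ s ⟧ₛ * ⟦ t ⟧ₛ) * ((m · 1#) * (n · 1#))   ≈⟨ interchange _ _ _ _ ⟩
    (⟦ s ⟧ₛ * (m · 1#)) * (⟦ t ⟧ₛ * (n · 1#))   ≈⟨ sym (*-cong (⟦⟧-signAbs i) (⟦⟧-signAbs j)) ⟩
    ⟦ i ⟧ * ⟦ j ⟧                               ∎
    where s = ℤ.sign i; t = ℤ.sign j; m = ℤ.∣ i ∣; n = ℤ.∣ j ∣

  ⟦⟧-neg : ∀ i → ⟦ ℤ.- i ⟧ ≈ - ⟦ i ⟧
  ⟦⟧-neg (+ zero)  = sym -0#≈0#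
  ⟦⟧-neg (+ suc n) = refl
  ⟦⟧-neg -[1+ n ]  = sym (-‿involutive _)

  ⟦⟧-+ : ∀ i j → ⟦ i ℤ.+ j ⟧ ≈ ⟦ i ⟧ + ⟦ j ⟧
  ⟦⟧-+ (+ m)    (+ n)    = ×-homo-+ 1# m n
  ⟦⟧-+ (+ m)    -[1+ n ] = ⟦⟧-⊖ m (suc n)
  ⟦⟧-+ -[1+ m ] (+ n)    = trans (⟦⟧-⊖ n (suc m)) (+-comm _ _)
  ⟦⟧-+ -[1+ m ] -[1+ n ] = begin
    - (suc (suc m ℕ.+ n) · 1#)           ≡⟨ ≡.cong (λ k → - (suc k · 1#)) (≡.sym (ℕ.+-suc m n)) ⟩
    - ((suc m ℕ.+ suc n) · 1#)           ≈⟨ -‿cong (×-homo-+ 1# (suc m) (suc n)) ⟩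
    - (suc m · 1# + suc n · 1#)           ≈⟨ sym (-‿+-comm _ _) ⟩
    - (suc m · 1#) + - (suc n · 1#)       ∎

  homomorphism : ℤ.+-*-rawRing ACR.-Raw-AlmostCommutative⟶ ACR.fromCommutativeRing R
  homomorphism = record
    { ⟦_⟧ = ⟦_⟧ ; +-homo = ⟦⟧-+ ; *-homo = ⟦⟧-* ; -‿homo = ⟦⟧-neg
    ; 0-homo = refl ; 1-homo = refl }

  ⟦⟧-≟ : ∀ i j → Maybe (⟦ i ⟧ ≈ ⟦ j ⟧)
  ⟦⟧-≟ i j with i ℤ.≟ j
  ... | yes ≡.refl = just refl
  ... | no _       = nothing

  open import Algebra.Solver.Ring ℤ.+-*-rawRing (ACR.fromCommutativeRing R) homomorphism ⟦⟧-≟ public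
    using (solve; Polynomial; _:=_; _:+_; _:*_; _:-_; :-_; con)

  :1 : ∀ {n} → Polynomial n
  :1 = con 1ℤ

module FieldArithmetic {ℓ₁ ℓ₂} (F : Field ℓ₁ ℓ₂) where
  open Field F public
  open IntegerCoefficientSolver commutativeRing public using (solve; _:=_; _:+_; _:*_; _:-_; :-_; :1)
  open import Algebra.Properties.CommutativeSemigroup *-commutativeSemigroup public
  open import Algebra.Properties.CommutativeSemigroup +-commutativeSemigroup public
    using () renaming (interchange to +-interchange)
  open import Relation.Binary.Reasoning.Setoid setoid

  infixl 6 _−_
  infixl 7 _÷_

  NZ : Carrier → Set ℓ₂
  NZ = Defs.NZ F

  _−_ : Carrier → Carrier → Carrier
  _−_ = Defs._−_ F

  _÷_ : Carrier → Carrier → Carrier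
  _÷_ = Defs._÷_ F

  pow : Carrier → ℕ → Carrier
  pow = Defs.pow F

  poch : Carrier → Carrier → ℕ → Carrier
  poch = Defs.poch F

  sumTo : ℕ → (ℕ → Carrier) → Carrier
  sumTo = Defs.sumTo F

  coef : Carrier → Carrier → Carrier → ℕ → ℕ → Carrier
  coef = Defs.coef F

  NZ-resp-≈ : ∀ {x y} → x ≈ y → NZ x → NZ y
  NZ-resp-≈ x≈y x≉0 y≈0 = x≉0 (trans x≈y y≈0)

  NZ-*ʳ : ∀ {x y} → NZ (x * y) → NZ y
  NZ-*ʳ {x} {y} xy≉0 y≈0 = xy≉0 (trans (*-congˡ y≈0) (zeroʳ x))

  ⁻¹-inverseˡ : ∀ {x} → NZ x → x ⁻¹ * x ≈ 1#
  ⁻¹-inverseˡ {x} x≉0 = trans (*-comm _ _) (⁻¹-inverse x x≉0)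

  *-cancelʳ : ∀ {x y z} → NZ z → x * z ≈ y * z → x ≈ y
  *-cancelʳ {x} {y} {z} z≉0 eq = begin
    x                 ≈⟨ *-identityʳ x ⟨
    x * 1#            ≈⟨ *-congˡ (⁻¹-inverse z z≉0) ⟨
    x * (z * z ⁻¹)    ≈⟨ *-assoc x z _ ⟨
    (x * z) * z ⁻¹    ≈⟨ *-congʳ eq ⟩
    (y * z) * z ⁻¹    ≈⟨ *-assoc y z _ ⟩
    y * (z * z ⁻¹)    ≈⟨ *-congˡ (⁻¹-inverse z z≉0) ⟩
    y * 1#            ≈⟨ *-identityʳ y ⟩
    y                 ∎

  *-≈0⇒≈0 : ∀ {x y} → NZ x → x * y ≈ 0# → y ≈ 0#
  *-≈0⇒≈0 {x} {y} x≉0 xy≈0 = *-cancelʳ x≉0 (trans (*-comm y x) (trans xy≈0 (sym (zeroˡ x))))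

  NZ-* : ∀ {x y} → NZ x → NZ y → NZ (x * y)
  NZ-* x≉0 y≉0 xy≈0 = y≉0 (*-≈0⇒≈0 x≉0 xy≈0)

  ⁻¹-unique : ∀ {x y} → NZ x → x * y ≈ 1# → y ≈ x ⁻¹
  ⁻¹-unique {x} {y} x≉0 xy≈1 =
    *-cancelʳ x≉0 (trans (*-comm y x) (trans xy≈1 (sym (⁻¹-inverseˡ x≉0))))

  ⁻¹-distrib-* : ∀ {x y} → NZ x → NZ y → (x * y) ⁻¹ ≈ x ⁻¹ * y ⁻¹
  ⁻¹-distrib-* {x} {y} x≉0 y≉0 = sym (⁻¹-unique (NZ-* x≉0 y≉0) (begin
    (x * y) * (x ⁻¹ * y ⁻¹)      ≈⟨ interchange x y _ _ ⟩
    (x * x ⁻¹) * (y * y ⁻¹)      ≈⟨ *-cong (⁻¹-inverse x x≉0) (⁻¹-inverse y y≉0) ⟩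
    1# * 1#                      ≈⟨ *-identityˡ 1# ⟩
    1#                           ∎))

  −-congʳ : ∀ {x y y′} → y ≈ y′ → x − y ≈ x − y′
  −-congʳ y≈y′ = +-congˡ (-‿cong y≈y′)

  1−-reflect : ∀ {x y} → x * y ≈ 1# → 1# − x ≈ (1# − y) * (- x)
  1−-reflect {x} {y} xy≈1 = sym (begin
    (1# − y) * (- x)   ≈⟨ solve 2 (λ x y → (:1 :- y) :* (:- x) := :- x :+ x :* y) refl x y ⟩
    - x + x * y        ≈⟨ +-congˡ xy≈1 ⟩
    - x + 1#           ≈⟨ +-comm _ _ ⟩
    1# − x             ∎)

  ÷-cong : ∀ {a b c d} → a ≈ c → b ≈ d → a ÷ b ≈ c ÷ d
  ÷-cong a≈c b≈d = *-cong a≈c (⁻¹-cong b≈d)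

  ÷-*ʳ : ∀ a b x → (a ÷ b) * x ≈ (a * x) ÷ b
  ÷-*ʳ a b x = xy∙z≈xz∙y a (b ⁻¹) x

  ÷-*-÷ : ∀ {a b c d} → NZ b → NZ d → (a ÷ b) * (c ÷ d) ≈ (a * c) ÷ (b * d)
  ÷-*-÷ {a} {b} {c} {d} b≉0 d≉0 = begin
    (a * b ⁻¹) * (c * d ⁻¹)   ≈⟨ interchange a _ c _ ⟩
    (a * c) * (b ⁻¹ * d ⁻¹)   ≈⟨ *-congˡ (⁻¹-distrib-* b≉0 d≉0) ⟨
    (a * c) * (b * d) ⁻¹      ∎

  ÷-cross : ∀ {a b c d} → NZ b → NZ d → a * d ≈ c * b → a ÷ b ≈ c ÷ d
  ÷-cross {a} {b} {c} {d} b≉0 d≉0 ad≈cb = *-cancelʳ (NZ-* b≉0 d≉0) (begin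
    (a * b ⁻¹) * (b * d)      ≈⟨ *-congˡ (*-comm b d) ⟩
    (a * b ⁻¹) * (d * b)      ≈⟨ interchange a _ d b ⟩
    (a * d) * (b ⁻¹ * b)      ≈⟨ *-cong ad≈cb (⁻¹-inverseˡ b≉0) ⟩
    (c * b) * 1#              ≈⟨ *-congˡ (⁻¹-inverseˡ d≉0) ⟨
    (c * b) * (d ⁻¹ * d)      ≈⟨ interchange c b _ d ⟩
    (c * d ⁻¹) * (b * d)      ∎)

  ÷-cancelʳ : ∀ {a b x} → NZ b → NZ x → (a * x) ÷ (b * x) ≈ a ÷ b
  ÷-cancelʳ {a} {b} {x} b≉0 x≉0 = ÷-cross (NZ-* b≉0 x≉0) b≉0 (xy∙z≈x∙zy a x b)

  ÷-self : ∀ {a b} → a ≈ b → NZ b → a ÷ b ≈ 1#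
  ÷-self a≈b b≉0 = trans (*-congʳ a≈b) (⁻¹-inverse _ b≉0)

  +-÷-cross : ∀ {a b u v d} → NZ d → a * d + b * u ≈ v → a + b * (u ÷ d) ≈ v ÷ d
  +-÷-cross {a} {b} {u} {v} {d} d≉0 eq = begin
    a + b * (u ÷ d)                  ≈⟨ +-cong a≈ad÷d (*-assoc b u _) ⟨
    (a * d) ÷ d + (b * u) ÷ d        ≈⟨ distribʳ (d ⁻¹) (a * d) (b * u) ⟨
    (a * d + b * u) ÷ d              ≈⟨ *-congʳ eq ⟩
    v ÷ d                            ∎
    where
    a≈ad÷d : (a * d) ÷ d ≈ a
    a≈ad÷d = trans (*-assoc a d _) (trans (*-congˡ (⁻¹-inverse d d≉0)) (*-identityʳ a))

  pow-+ : ∀ x m n → pow x (m +ℕ n) ≈ pow x m * pow x n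
  pow-+ x zero    n = sym (*-identityˡ _)
  pow-+ x (suc m) n = trans (*-congˡ (pow-+ x m n)) (sym (*-assoc x _ _))

  pow-+-+ : ∀ x a b c → pow x (a +ℕ (b +ℕ c)) ≈ pow x a * (pow x b * pow x c)
  pow-+-+ x a b c = trans (pow-+ x a _) (*-congˡ (pow-+ x b c))

  pow-⁻¹ : ∀ {x} → NZ x → ∀ n → pow (x ⁻¹) n * pow x n ≈ 1#
  pow-⁻¹ x≉0 zero    = *-identityˡ 1#
  pow-⁻¹ {x} x≉0 (suc n) = begin
    (x ⁻¹ * pow (x ⁻¹) n) * (x * pow x n)  ≈⟨ interchange (x ⁻¹) _ x _ ⟩
    (x ⁻¹ * x) * (pow (x ⁻¹) n * pow x n)  ≈⟨ *-cong (⁻¹-inverseˡ x≉0) (pow-⁻¹ x≉0 n) ⟩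
    1# * 1#                                ≈⟨ *-identityˡ 1# ⟩
    1#                                     ∎

  poch-cong : ∀ {x y} q n → x ≈ y → poch x q n ≈ poch y q n
  poch-cong q zero    x≈y = refl
  poch-cong q (suc n) x≈y = *-cong (poch-cong q n x≈y) (+-congˡ (-‿cong (*-congʳ x≈y)))

  poch-+ : ∀ x q m n → poch x q (m +ℕ n) ≈ poch x q m * poch (x * pow q m) q n
  poch-+ x q m zero = begin
    poch x q (m +ℕ 0)   ≡⟨ ≡.cong (poch x q) (ℕ.+-identityʳ m) ⟩
    poch x q m          ≈⟨ *-identityʳ _ ⟨
    poch x q m * 1#     ∎
  poch-+ x q m (suc n) = begin
    poch x q (m +ℕ suc n)
      ≡⟨ ≡.cong (poch x q) (ℕ.+-suc m n) ⟩
    poch x q (m +ℕ n) * (1# − x * pow q (m +ℕ n))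
      ≈⟨ *-cong (poch-+ x q m n) (+-congˡ (-‿cong (*-congˡ (pow-+ q m n)))) ⟩
    (poch x q m * poch (x * pow q m) q n) * (1# − x * (pow q m * pow q n))
      ≈⟨ *-assoc _ _ _ ⟩
    poch x q m * (poch (x * pow q m) q n * (1# − x * (pow q m * pow q n)))
      ≈⟨ *-congˡ (*-congˡ (+-congˡ (-‿cong (*-assoc x _ _)))) ⟨
    poch x q m * poch (x * pow q m) q (suc n)
      ∎

  poch-+-shift : ∀ x q m n → poch (x * q) q (m +ℕ n) ≈ poch (x * q) q m * poch (x * pow q (suc m)) q n
  poch-+-shift x q m n = trans (poch-+ (x * q) q m n) (*-congˡ (poch-cong q n (*-assoc x q _)))

  poch-suc : ∀ x q n → poch x q (suc n) ≈ (1# − x) * poch (x * q) q n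
  poch-suc x q n = begin
    poch x q (1 +ℕ n)                   ≈⟨ poch-+ x q 1 n ⟩
    poch x q 1 * poch (x * pow q 1) q n ≈⟨ *-cong first (poch-cong q n (*-congˡ (*-identityʳ q))) ⟩
    (1# − x) * poch (x * q) q n         ∎
    where
    first : poch x q 1 ≈ 1# − x
    first = trans (*-identityˡ _) (+-congˡ (-‿cong (*-identityʳ x)))

module FiniteSums {ℓ₁ ℓ₂} (F : Field ℓ₁ ℓ₂) where
  open FieldArithmetic F
  open import Relation.Binary.Reasoning.Setoid setoid

  sumTo-cong : ∀ n {f g : ℕ → Carrier} → (∀ i → i ≤ n → f i ≈ g i) → sumTo n f ≈ sumTo n g
  sumTo-cong zero    f≈g = f≈g 0 z≤n
  sumTo-cong (suc n) f≈g =
    +-cong (sumTo-cong n (λ i i≤n → f≈g i (ℕ.m≤n⇒m≤1+n i≤n))) (f≈g (suc n) ℕ.≤-refl)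

  sumTo-cong′ : ∀ n {f g : ℕ → Carrier} → (∀ i → f i ≈ g i) → sumTo n f ≈ sumTo n g
  sumTo-cong′ n f≈g = sumTo-cong n (λ i _ → f≈g i)

  sumTo-+ : ∀ n (f g : ℕ → Carrier) → sumTo n (λ i → f i + g i) ≈ sumTo n f + sumTo n g
  sumTo-+ zero    f g = refl
  sumTo-+ (suc n) f g = trans (+-congʳ (sumTo-+ n f g)) (+-interchange _ _ _ _)

  sumTo-*ˡ : ∀ n a (f : ℕ → Carrier) → a * sumTo n f ≈ sumTo n (λ i → a * f i)
  sumTo-*ˡ zero    a f = refl
  sumTo-*ˡ (suc n) a f = trans (distribˡ a _ _) (+-congʳ (sumTo-*ˡ n a f))

  sumTo-*ʳ : ∀ n a (f : ℕ → Carrier) → sumTo n f * a ≈ sumTo n (λ i → f i * a)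
  sumTo-*ʳ zero    a f = refl
  sumTo-*ʳ (suc n) a f = trans (distribʳ a _ _) (+-congʳ (sumTo-*ʳ n a f))

  sumTo-last : ∀ n (f : ℕ → Carrier) → (∀ i → i < n → f i ≈ 0#) → sumTo n f ≈ f n
  sumTo-last zero    f f≈0 = refl
  sumTo-last (suc n) f f≈0 = begin
    sumTo n f + f (suc n)  ≈⟨ +-congʳ (trans (sumTo-last n f f<n≈0) (f≈0 n ℕ.≤-refl)) ⟩
    0# + f (suc n)         ≈⟨ +-identityˡ _ ⟩
    f (suc n)              ∎
    where
    f<n≈0 : ∀ i → i < n → f i ≈ 0#
    f<n≈0 i i<n = f≈0 i (ℕ.m≤n⇒m≤1+n i<n)

  sumTo-triangle : ∀ n (f : ℕ → ℕ → Carrier) →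
    sumTo n (λ m → sumTo m (λ j → f j m)) ≈ sumTo n (λ j → sumTo (n ∸ j) (λ r → f j (r +ℕ j)))
  sumTo-triangle zero    f = refl
  sumTo-triangle (suc n) f = begin
    sumTo n (λ m → sumTo m (λ j → f j m)) + (sumTo n (λ j → f j (suc n)) + f (suc n) (suc n))
      ≈⟨ +-congʳ (sumTo-triangle n f) ⟩
    sumTo n (λ j → sumTo (n ∸ j) (g j)) + (sumTo n (λ j → f j (suc n)) + f (suc n) (suc n))
      ≈⟨ +-assoc _ _ _ ⟨
    (sumTo n (λ j → sumTo (n ∸ j) (g j)) + sumTo n (λ j → f j (suc n))) + f (suc n) (suc n)
      ≈⟨ +-cong (sumTo-+ n _ _) diagonal ⟨
    sumTo n (λ j → sumTo (n ∸ j) (g j) + f j (suc n)) + sumTo (n ∸ n) (g (suc n))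
      ≈⟨ +-congʳ (sumTo-cong n extend) ⟨
    sumTo n (λ j → sumTo (suc n ∸ j) (g j)) + sumTo (n ∸ n) (g (suc n))
      ∎
    where
    g : ℕ → ℕ → Carrier
    g j r = f j (r +ℕ j)

    extend : ∀ j → j ≤ n → sumTo (suc n ∸ j) (g j) ≈ sumTo (n ∸ j) (g j) + f j (suc n)
    extend j j≤n = begin
      sumTo (suc n ∸ j) (g j)
        ≡⟨ ≡.cong (λ d → sumTo d (g j)) (ℕ.+-∸-assoc 1 j≤n) ⟩
      sumTo (n ∸ j) (g j) + f j (suc (n ∸ j +ℕ j))
        ≡⟨ ≡.cong (λ m → sumTo (n ∸ j) (g j) + f j (suc m)) (ℕ.m∸n+n≡m j≤n) ⟩
      sumTo (n ∸ j) (g j) + f j (suc n) ∎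

    diagonal : sumTo (n ∸ n) (g (suc n)) ≈ f (suc n) (suc n)
    diagonal = reflexive (≡.cong (λ d → sumTo d (g (suc n))) (ℕ.n∸n≡0 n))

  sumTo-inverse : (P M : ℕ → ℕ → Carrier)
    → (∀ m → P m m * M m m ≈ 1#)
    → (∀ i m → i < m → sumTo (m ∸ i) (λ t → P m (t +ℕ i) * M (t +ℕ i) i) ≈ 0#)
    → ∀ m (α : ℕ → Carrier) → sumTo m (λ j → P m j * sumTo j (λ i → M j i * α i)) ≈ α m
  sumTo-inverse P M diagonal orthogonal m α = begin
    sumTo m (λ j → P m j * sumTo j (λ i → M j i * α i))
      ≈⟨ sumTo-cong′ m (λ j → sumTo-*ˡ j (P m j) _) ⟩
    sumTo m (λ j → sumTo j (λ i → P m j * (M j i * α i)))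
      ≈⟨ sumTo-triangle m (λ i j → P m j * (M j i * α i)) ⟩
    sumTo m (λ i → sumTo (m ∸ i) (λ t → P m (t +ℕ i) * (M (t +ℕ i) i * α i)))
      ≈⟨ sumTo-cong′ m (λ i → trans (sumTo-cong′ (m ∸ i) (λ t → sym (*-assoc _ _ _)))
                                     (sym (sumTo-*ʳ (m ∸ i) (α i) _))) ⟩
    sumTo m (λ i → PM i * α i)
      ≈⟨ sumTo-last m (λ i → PM i * α i) (λ i i<m → trans (*-congʳ (orthogonal i m i<m)) (zeroˡ _)) ⟩
    PM m * α m
      ≈⟨ *-congʳ (trans (reflexive (≡.cong (λ d → sumTo d (λ t → P m (t +ℕ m) * M (t +ℕ m) m)) (ℕ.n∸n≡0 m)))
                        (diagonal m)) ⟩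
    1# * α m
      ≈⟨ *-identityˡ _ ⟩
    α m ∎
    where
    PM : ℕ → Carrier
    PM i = sumTo (m ∸ i) (λ t → P m (t +ℕ i) * M (t +ℕ i) i)

  bailey-transform : ∀ n (P M : ℕ → ℕ → Carrier) (α β C : ℕ → Carrier) (W : ℕ → ℕ → Carrier)
    → (∀ m → P m m * M m m ≈ 1#)
    → (∀ i m → i < m → sumTo (m ∸ i) (λ t → P m (t +ℕ i) * M (t +ℕ i) i) ≈ 0#)
    → (∀ j → β j ≈ sumTo j (λ i → M j i * α i))
    → (∀ j r → j ≤ n → r ≤ n ∸ j → W j r ≈ P (r +ℕ j) j * C (r +ℕ j))
    → sumTo n (λ j → β j * sumTo (n ∸ j) (W j)) ≈ sumTo n (λ m → C m * α m)
  bailey-transform n P M α β C W diagonal orthogonal β≈Mα W≈PC = begin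
    sumTo n (λ j → β j * sumTo (n ∸ j) (W j))
      ≈⟨ sumTo-cong n (λ j j≤n → trans (*-cong (β≈Mα j) (sumTo-cong (n ∸ j) (λ r → W≈PC j r j≤n)))
                                        (sumTo-*ˡ (n ∸ j) _ _)) ⟩
    sumTo n (λ j → sumTo (n ∸ j) (λ r → Mα j * (P (r +ℕ j) j * C (r +ℕ j))))
      ≈⟨ sumTo-triangle n (λ j m → Mα j * (P m j * C m)) ⟨
    sumTo n (λ m → sumTo m (λ j → Mα j * (P m j * C m)))
      ≈⟨ sumTo-cong′ n (λ m → trans (sumTo-cong′ m (λ j → x∙yz≈yx∙z _ _ _)) (sym (sumTo-*ʳ m (C m) _))) ⟩
    sumTo n (λ m → sumTo m (λ j → P m j * Mα j) * C m)
      ≈⟨ sumTo-cong′ n (λ m → trans (*-congʳ (sumTo-inverse P M diagonal orthogonal m α)) (*-comm _ _)) ⟩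
    sumTo n (λ m → C m * α m) ∎
    where
    Mα : ℕ → Carrier
    Mα j = sumTo j (λ i → M j i * α i)

exponent-A : ∀ p t i → suc (p +ℕ (t +ℕ i)) +ℕ (t +ℕ i) ≡ suc (p +ℕ (t +ℕ (t +ℕ (i +ℕ i))))
exponent-A = solve-∀

exponent-m+i : ∀ p t i → suc (p +ℕ (t +ℕ i)) +ℕ i ≡ suc (p +ℕ (t +ℕ (i +ℕ i)))
exponent-m+i = solve-∀

exponent-2j : ∀ t i → 2 *ℕ suc (t +ℕ i) ≡ suc (suc (t +ℕ (t +ℕ (i +ℕ i))))
exponent-2j = solve-∀

exponent-m∸i : ∀ p t i → suc (p +ℕ (t +ℕ i)) ∸ i ≡ suc (p +ℕ t)
exponent-m∸i p t i = ≡.trans (≡.cong (_∸ i) (≡.sym (ℕ.+-assoc (suc p) t i))) (ℕ.m+n∸n≡m (suc (p +ℕ t)) i)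

module BaileyInverse {ℓ₁ ℓ₂} (F : Field ℓ₁ ℓ₂) (q e c : Field.Carrier F) where
  open FieldArithmetic F
  open import Relation.Binary.Reasoning.Setoid setoid

  z : Carrier
  z = c ÷ e

  diffProd : ℕ → Carrier
  diffProd zero    = 1#
  diffProd (suc d) = diffProd d * (z − pow q d)

  baileyInverse : ℕ → ℕ → Carrier
  baileyInverse m j =
    ((((1# − c * pow q (2 *ℕ j)) * (1# − e * pow q (2 *ℕ m))) * poch e q (m +ℕ j)) * diffProd (m ∸ j))
      ÷ ((((1# − c) * (1# − e)) * poch (c * q) q (m +ℕ j)) * poch q q (m ∸ j))

  module _ (e≉0 : NZ e) (1-c≉0 : NZ (1# − c)) (1-e≉0 : NZ (1# − e)) (qq≉0 : ∀ n → NZ (poch q q n))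
           (cq≉0 : ∀ n → NZ (poch (c * q) q n)) (eq≉0 : ∀ n → NZ (poch (e * q) q n)) where

    baileyInverse-diagonal : ∀ m → baileyInverse m m * coef q e c m m ≈ 1#
    baileyInverse-diagonal m rewrite ℕ.n∸n≡0 m | ℕ.+-identityʳ m = begin
      ((((oc′ * oe′) * Pe) * 1#) ÷ (((oc * oe) * Dc) * 1#)) * ((1# * Pc) ÷ (1# * De))
        ≈⟨ ÷-*-÷ left≉0 right≉0 ⟩
      ((((oc′ * oe′) * Pe) * 1#) * (1# * Pc)) ÷ ((((oc * oe) * Dc) * 1#) * (1# * De))
        ≈⟨ ÷-self numerator≈denominator (NZ-* left≉0 right≉0) ⟩
      1# ∎
      where
      n = m +ℕ m
      oc = 1# − c
      oe = 1# − e
      oc′ = 1# − c * pow q n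
      oe′ = 1# − e * pow q n
      Pe = poch e q n
      Pc = poch c q n
      Dc = poch (c * q) q n
      De = poch (e * q) q n
      left≉0 : NZ (((oc * oe) * Dc) * 1#)
      left≉0 = NZ-resp-≈ (sym (*-identityʳ _)) (NZ-* (NZ-* 1-c≉0 1-e≉0) (cq≉0 n))
      right≉0 : NZ (1# * De)
      right≉0 = NZ-resp-≈ (sym (*-identityˡ _)) (eq≉0 n)
      numerator≈denominator : (((oc′ * oe′) * Pe) * 1#) * (1# * Pc) ≈ (((oc * oe) * Dc) * 1#) * (1# * De)
      numerator≈denominator = begin
        (((oc′ * oe′) * Pe) * 1#) * (1# * Pc)
          ≈⟨ solve 4 (λ a b pe pc → (((a :* b) :* pe) :* :1) :* (:1 :* pc) := (pc :* a) :* (pe :* b))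
                     refl oc′ oe′ Pe Pc ⟩
        (Pc * oc′) * (Pe * oe′)
          ≈⟨ *-cong (poch-suc c q n) (poch-suc e q n) ⟩
        (oc * Dc) * (oe * De)
          ≈⟨ solve 4 (λ a b dc de → (a :* dc) :* (b :* de) := (((a :* b) :* dc) :* :1) :* (:1 :* de)) refl oc oe Dc De ⟩
        (((oc * oe) * Dc) * 1#) * (1# * De) ∎

    summand : ℕ → ℕ → ℕ → Carrier
    summand i m t = baileyInverse m (t +ℕ i) * coef q e c (t +ℕ i) i

    telescopeFactor : ℕ → ℕ → Carrier
    telescopeFactor i m = (1# − e * pow q (m +ℕ i)) * (1# − pow q (m ∸ i))

    -- The last argument A stands for m + (t + i); it is kept free so that index arithmetic can be
    -- transported with ≡.cong through these named functions.
    commonNumerator : ℕ → ℕ → ℕ → ℕ → ℕ → Carrier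
    commonNumerator i m t p A =
      ((((1# − e * pow q (2 *ℕ m)) * poch e q (suc A)) * poch c q (suc (t +ℕ i +ℕ i))) * diffProd p)
        * poch (z * q) q t

    commonDenominator : ℕ → ℕ → ℕ → ℕ → Carrier
    commonDenominator i t p A =
      (((((1# − c) * (1# − e)) * poch (c * q) q A) * poch (e * q) q (t +ℕ i +ℕ i)) * poch q q p) * poch q q t

    closedForm : ℕ → ℕ → ℕ → ℕ → Carrier
    closedForm i m t p = (commonNumerator i m t p A ÷ commonDenominator i t p A) * (1# − pow q p)
      where A = m +ℕ (t +ℕ i)

    commonDenominator≉0 : ∀ i t p A → NZ (commonDenominator i t p A)
    commonDenominator≉0 i t p A =
      NZ-* (NZ-* (NZ-* (NZ-* (NZ-* 1-c≉0 1-e≉0) (cq≉0 A)) (eq≉0 (t +ℕ i +ℕ i))) (qq≉0 p)) (qq≉0 t)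

    stepDenominator : ℕ → ℕ → ℕ → Carrier
    stepDenominator i t A =
      ((1# − (c * q) * pow q A) * (1# − q * pow q t)) * (1# − (e * q) * pow q (t +ℕ i +ℕ i))

    stepDenominator≉0 : ∀ i t A → NZ (stepDenominator i t A)
    stepDenominator≉0 i t A =
      NZ-* (NZ-* (NZ-*ʳ (cq≉0 (suc A))) (NZ-*ʳ (qq≉0 (suc t)))) (NZ-*ʳ (eq≉0 (suc (t +ℕ i +ℕ i))))

    closedForm-suc-p : ∀ i m t p → let A = m +ℕ (t +ℕ i) in
      closedForm i m t (suc p) ≈ (commonNumerator i m t p A ÷ commonDenominator i t p A) * (z − pow q p)
    closedForm-suc-p i m t p = begin
      (commonNumerator i m t (suc p) A ÷ commonDenominator i t (suc p) A) * (1# − q * pow q p)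
        ≈⟨ ÷-*ʳ _ _ _ ⟩
      (commonNumerator i m t (suc p) A * (1# − q * pow q p)) ÷ commonDenominator i t (suc p) A
        ≈⟨ ÷-cong (solve 5 (λ a π zx ζ ox → ((a :* (π :* zx)) :* ζ) :* ox := (((a :* π) :* ζ) :* zx) :* ox)
                           refl _ _ _ _ _)
                  (solve 4 (λ a qp ox qt → (a :* (qp :* ox)) :* qt := ((a :* qp) :* qt) :* ox) refl _ _ _ _) ⟩
      (commonNumerator i m t p A * (z − pow q p) * (1# − q * pow q p))
        ÷ (commonDenominator i t p A * (1# − q * pow q p))
        ≈⟨ ÷-cancelʳ (commonDenominator≉0 i t p A) (NZ-*ʳ (qq≉0 (suc p))) ⟩
      (commonNumerator i m t p A * (z − pow q p)) ÷ commonDenominator i t p A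
        ≈⟨ ÷-*ʳ _ _ _ ⟨
      (commonNumerator i m t p A ÷ commonDenominator i t p A) * (z − pow q p) ∎
      where A = m +ℕ (t +ℕ i)

    closedForm-suc-t : ∀ i m t p → let A = m +ℕ (t +ℕ i); B = t +ℕ i +ℕ i in
      closedForm i m (suc t) p
        ≈ (commonNumerator i m t p A ÷ commonDenominator i t p A)
          * (((((1# − pow q p) * (1# − e * (q * pow q A))) * (1# − c * (q * pow q B))) * (1# − (z * q) * pow q t))
             ÷ stepDenominator i t A)
    closedForm-suc-t i m t p = begin
      (commonNumerator i m (suc t) p (m +ℕ suc (t +ℕ i)) ÷ commonDenominator i (suc t) p (m +ℕ suc (t +ℕ i)))
        * (1# − pow q p)
        ≡⟨ ≡.cong (λ A′ → (commonNumerator i m (suc t) p A′ ÷ commonDenominator i (suc t) p A′) * (1# − pow q p))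
                  (ℕ.+-suc m (t +ℕ i)) ⟩
      (commonNumerator i m (suc t) p (suc A) ÷ commonDenominator i (suc t) p (suc A)) * (1# − pow q p)
        ≈⟨ ÷-*ʳ _ _ _ ⟩
      (commonNumerator i m (suc t) p (suc A) * (1# − pow q p)) ÷ commonDenominator i (suc t) p (suc A)
        ≈⟨ ÷-cong (solve 9 (λ ae e₁ b₁ c₁ b₂ π ζ b₃ ox →
                      ((((ae :* (e₁ :* b₁)) :* (c₁ :* b₂)) :* π) :* (ζ :* b₃)) :* ox
                      := ((((ae :* e₁) :* c₁) :* π) :* ζ) :* (((ox :* b₁) :* b₂) :* b₃))
                    refl _ _ _ _ _ _ _ _ _)
                  (solve 8 (λ oo dc a₁ de a₃ qp qt a₂ →
                      (((oo :* (dc :* a₁)) :* (de :* a₃)) :* qp) :* (qt :* a₂)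
                      := ((((oo :* dc) :* de) :* qp) :* qt) :* ((a₁ :* a₂) :* a₃))
                    refl _ _ _ _ _ _ _ _) ⟩
      (commonNumerator i m t p A * _) ÷ (commonDenominator i t p A * stepDenominator i t A)
        ≈⟨ ÷-*-÷ (commonDenominator≉0 i t p A) (stepDenominator≉0 i t A) ⟨
      (commonNumerator i m t p A ÷ commonDenominator i t p A) * (_ ÷ stepDenominator i t A) ∎
      where A = m +ℕ (t +ℕ i)

    summand-suc : ∀ i m t p → m ≡ suc (p +ℕ (t +ℕ i)) → let A = m +ℕ (t +ℕ i) in
      summand i m (suc t)
        ≈ (commonNumerator i m t p A ÷ commonDenominator i t p A)
          * (((1# − c * pow q (2 *ℕ suc (t +ℕ i))) * (1# − z)) ÷ stepDenominator i t A)
    summand-suc i _ t p ≡.refl = begin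
      baileyInverse m (suc j) * coef q e c (suc j) i
        ≡⟨ ≡.cong₂ (λ s d → entry s d * coef q e c (suc j) i) (ℕ.+-suc m j) (ℕ.m+n∸n≡m p j) ⟩
      entry (suc A) p * coef q e c (suc j) i
        ≡⟨ ≡.cong (λ d → entry (suc A) p * ((poch z q d * poch c q (suc B)) ÷ (poch q q d * poch (e * q) q (suc B))))
                  (ℕ.m+n∸n≡m (suc t) i) ⟩
      entry (suc A) p * ((poch z q (suc t) * poch c q (suc B)) ÷ (poch q q (suc t) * poch (e * q) q (suc B)))
        ≈⟨ ÷-*-÷ (NZ-* (NZ-* (NZ-* 1-c≉0 1-e≉0) (cq≉0 (suc A))) (qq≉0 p)) (NZ-* (qq≉0 (suc t)) (eq≉0 (suc B))) ⟩
      _ ÷ _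
        ≈⟨ ÷-cong (trans (*-congˡ (*-congʳ (poch-suc z q t)))
                         (solve 7 (λ c₂ ae e₁ π oz ζ c₁ →
                             (((c₂ :* ae) :* e₁) :* π) :* ((oz :* ζ) :* c₁)
                             := ((((ae :* e₁) :* c₁) :* π) :* ζ) :* (c₂ :* oz))
                           refl _ _ _ _ _ _ _))
                  (solve 8 (λ oo dc a₁ qp qt a₂ de a₃ →
                      ((oo :* (dc :* a₁)) :* qp) :* ((qt :* a₂) :* (de :* a₃))
                      := ((((oo :* dc) :* de) :* qp) :* qt) :* ((a₁ :* a₂) :* a₃))
                    refl _ _ _ _ _ _ _ _) ⟩
      (commonNumerator i m t p A * _) ÷ (commonDenominator i t p A * stepDenominator i t A)
        ≈⟨ ÷-*-÷ (commonDenominator≉0 i t p A) (stepDenominator≉0 i t A) ⟨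
      (commonNumerator i m t p A ÷ commonDenominator i t p A) * (_ ÷ stepDenominator i t A) ∎
      where
      j = t +ℕ i
      m = suc (p +ℕ j)
      A = m +ℕ j
      B = j +ℕ i
      entry : ℕ → ℕ → Carrier
      entry s d = ((((1# − c * pow q (2 *ℕ suc j)) * (1# − e * pow q (2 *ℕ m))) * poch e q s) * diffProd d)
                    ÷ ((((1# − c) * (1# − e)) * poch (c * q) q s) * poch q q d)

    telescope-base : ∀ i m p → m ≡ p +ℕ i → telescopeFactor i m * summand i m 0 ≈ closedForm i m 0 p
    telescope-base i _ p ≡.refl = begin
      telescopeFactor i m′ * (baileyInverse m′ i * coef q e c i i)
        ≡⟨ ≡.trans (≡.cong₂ (λ d k → shape d k (i ∸ i)) (ℕ.m+n∸n≡m p i) (≡.cong (i +ℕ_) (ℕ.+-identityʳ i)))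
                   (≡.cong (shape p (i +ℕ i)) (ℕ.n∸n≡0 i)) ⟩
      E * ((Pn ÷ Pd) * ((1# * poch c q B) ÷ (1# * poch (e * q) q B)))
        ≈⟨ *-congˡ (÷-*-÷ (NZ-* (NZ-* (NZ-* 1-c≉0 1-e≉0) (cq≉0 A)) (qq≉0 p))
                          (NZ-resp-≈ (sym (*-identityˡ _)) (eq≉0 B))) ⟩
      E * ((Pn * (1# * poch c q B)) ÷ (Pd * (1# * poch (e * q) q B)))
        ≈⟨ *-assoc E _ _ ⟨
      (E * (Pn * (1# * poch c q B))) ÷ (Pd * (1# * poch (e * q) q B))
        ≈⟨ ÷-cong (solve 7 (λ oe′ ox oc′ ae pe π pc →
                      (oe′ :* ox) :* ((((oc′ :* ae) :* pe) :* π) :* (:1 :* pc))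
                      := ((((ae :* (pe :* oe′)) :* (pc :* oc′)) :* π) :* :1) :* ox)
                    refl _ _ _ _ _ _ _)
                  (solve 4 (λ oo dc qp de → ((oo :* dc) :* qp) :* (:1 :* de) := ((((oo :* dc) :* de) :* qp) :* :1))
                    refl _ _ _ _) ⟩
      (commonNumerator i m′ 0 p A * (1# − pow q p)) ÷ commonDenominator i 0 p A
        ≈⟨ ÷-*ʳ _ _ _ ⟨
      closedForm i m′ 0 p ∎
      where
      m′ = p +ℕ i
      A = m′ +ℕ i
      B = i +ℕ i
      E = (1# − e * pow q A) * (1# − pow q p)
      Pn = (((1# − c * pow q B) * (1# − e * pow q (2 *ℕ m′))) * poch e q A) * diffProd p
      Pd = (((1# − c) * (1# − e)) * poch (c * q) q A) * poch q q p
      shape : ℕ → ℕ → ℕ → Carrier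
      shape d k d′ =
        ((1# − e * pow q A) * (1# − pow q d))
        * ((((((1# − c * pow q k) * (1# − e * pow q (2 *ℕ m′))) * poch e q A) * diffProd d)
             ÷ ((((1# − c) * (1# − e)) * poch (c * q) q A) * poch q q d))
           * ((poch z q d′ * poch c q B) ÷ (poch q q d′ * poch (e * q) q B)))

    ze≈c : z * e ≈ c
    ze≈c = trans (*-assoc c _ e) (trans (*-congˡ (⁻¹-inverseˡ e≉0)) (*-identityʳ c))

    -- One telescoping step with the common factor commonNumerator ÷ commonDenominator divided out,
    -- written in x = q^p, y = q^t, w = q^i.
    telescoping-identity : ∀ {x y w PA PB Pmi Pm-i P2} →
      let MB = y * (w * w); MA = q * (x * (y * MB)) in
      PA ≈ MA → PB ≈ MB → Pmi ≈ q * (x * MB) → Pm-i ≈ q * (x * y) → P2 ≈ q * (q * (y * MB)) →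
      (z − x) * (((1# − (c * q) * PA) * (1# − q * y)) * (1# − (e * q) * PB))
        + ((1# − e * Pmi) * (1# − Pm-i)) * ((1# − c * P2) * (1# − z))
      ≈ (((1# − x) * (1# − e * (q * PA))) * (1# − c * (q * PB))) * (1# − (z * q) * y)
    telescoping-identity {x} {y} {w} {PA} {PB} {Pmi} {Pm-i} {P2} PA≈ PB≈ Pmi≈ Pm-i≈ P2≈ = begin
      (z − x) * (((1# − (c * q) * PA) * (1# − q * y)) * (1# − (e * q) * PB))
        + ((1# − e * Pmi) * (1# − Pm-i)) * ((1# − c * P2) * (1# − z))
        ≈⟨ +-cong (*-congˡ (*-cong (*-congʳ (−-congʳ (*-cong (*-congʳ c≈ze) PA≈))) (−-congʳ (*-congˡ PB≈))))
                  (*-cong (*-cong (−-congʳ (*-congˡ Pmi≈)) (−-congʳ Pm-i≈)) (*-congʳ (−-congʳ (*-cong c≈ze P2≈)))) ⟩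
      (z − x) * (((1# − ((z * e) * q) * MA) * (1# − q * y)) * (1# − (e * q) * MB))
        + ((1# − e * (q * (x * MB))) * (1# − q * (x * y))) * ((1# − (z * e) * (q * (q * (y * MB)))) * (1# − z))
        ≈⟨ solve 6 (λ z e q x y w →
             let MB = y :* (w :* w); MA = q :* (x :* (y :* MB)) in
             (z :- x) :* (((:1 :- ((z :* e) :* q) :* MA) :* (:1 :- q :* y)) :* (:1 :- (e :* q) :* MB))
               :+ ((:1 :- e :* (q :* (x :* MB))) :* (:1 :- q :* (x :* y)))
                  :* ((:1 :- (z :* e) :* (q :* (q :* (y :* MB)))) :* (:1 :- z))
             := (((:1 :- x) :* (:1 :- e :* (q :* MA))) :* (:1 :- (z :* e) :* (q :* MB))) :* (:1 :- (z :* q) :* y))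
             refl z e q x y w ⟩
      (((1# − x) * (1# − e * (q * MA))) * (1# − (z * e) * (q * MB))) * (1# − (z * q) * y)
        ≈⟨ *-congʳ (*-cong (*-congˡ (−-congʳ (*-congˡ (*-congˡ PA≈)))) (−-congʳ (*-cong c≈ze (*-congˡ PB≈)))) ⟨
      (((1# − x) * (1# − e * (q * PA))) * (1# − c * (q * PB))) * (1# − (z * q) * y) ∎
      where
      MB = y * (w * w)
      MA = q * (x * (y * MB))
      c≈ze = sym ze≈c

    telescope-step : ∀ i m t p → m ≡ suc (p +ℕ (t +ℕ i)) →
      closedForm i m t (suc p) + telescopeFactor i m * summand i m (suc t) ≈ closedForm i m (suc t) p
    telescope-step i m t p m≡ = begin
      closedForm i m t (suc p) + E * summand i m (suc t)
        ≈⟨ +-cong (closedForm-suc-p i m t p) (*-congˡ (summand-suc i m t p m≡)) ⟩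
      K * (z − pow q p) + E * (K * (_ ÷ stepDenominator i t A))
        ≈⟨ +-congˡ (x∙yz≈y∙xz E K _) ⟩
      K * (z − pow q p) + K * (E * (_ ÷ stepDenominator i t A))
        ≈⟨ distribˡ K _ _ ⟨
      K * ((z − pow q p) + E * (_ ÷ stepDenominator i t A))
        ≈⟨ *-congˡ (+-÷-cross (stepDenominator≉0 i t A) (telescoping-identity powA powB powmi powm-i pow2)) ⟩
      K * (_ ÷ stepDenominator i t A)
        ≈⟨ closedForm-suc-t i m t p ⟨
      closedForm i m (suc t) p ∎
      where
      j = t +ℕ i
      A = m +ℕ j
      E = telescopeFactor i m
      K = commonNumerator i m t p A ÷ commonDenominator i t p A
      x = pow q p
      y = pow q t
      w = pow q i
      pow-≡ : ∀ {a b} → a ≡ b → pow q a ≈ pow q b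
      pow-≡ a≡b = reflexive (≡.cong (pow q) a≡b)
      powA : pow q A ≈ q * (x * (y * (y * (w * w))))
      powA = trans (pow-≡ (≡.cong (_+ℕ j) m≡)) (trans (pow-≡ (exponent-A p t i))
               (*-congˡ (trans (pow-+ q p _) (*-congˡ (trans (pow-+ q t _) (*-congˡ (pow-+-+ q t i i)))))))
      powB : pow q (j +ℕ i) ≈ y * (w * w)
      powB = trans (pow-≡ (ℕ.+-assoc t i i)) (pow-+-+ q t i i)
      powmi : pow q (m +ℕ i) ≈ q * (x * (y * (w * w)))
      powmi = trans (pow-≡ (≡.cong (_+ℕ i) m≡)) (trans (pow-≡ (exponent-m+i p t i))
               (*-congˡ (trans (pow-+ q p _) (*-congˡ (pow-+-+ q t i i)))))
      powm-i : pow q (m ∸ i) ≈ q * (x * y)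
      powm-i = trans (pow-≡ (≡.cong (_∸ i) m≡)) (trans (pow-≡ (exponent-m∸i p t i)) (*-congˡ (pow-+ q p t)))
      pow2 : pow q (2 *ℕ suc j) ≈ q * (q * (y * (y * (w * w))))
      pow2 = trans (pow-≡ (exponent-2j t i)) (*-congˡ (*-congˡ (trans (pow-+ q t _) (*-congˡ (pow-+-+ q t i i)))))

    telescope : ∀ i m t p → m ≡ p +ℕ (t +ℕ i) → telescopeFactor i m * sumTo t (summand i m) ≈ closedForm i m t p
    telescope i m zero    p m≡ = telescope-base i m p m≡
    telescope i m (suc t) p m≡ = begin
      E * (sumTo t (summand i m) + summand i m (suc t))    ≈⟨ distribˡ E _ _ ⟩
      E * sumTo t (summand i m) + E * summand i m (suc t)  ≈⟨ +-congʳ (telescope i m t (suc p) m≡′) ⟩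
      closedForm i m t (suc p) + E * summand i m (suc t)   ≈⟨ telescope-step i m t p m≡′ ⟩
      closedForm i m (suc t) p                             ∎
      where
      E = telescopeFactor i m
      m≡′ : m ≡ suc (p +ℕ (t +ℕ i))
      m≡′ = ≡.trans m≡ (ℕ.+-suc p (t +ℕ i))

    telescopeFactor≉0 : ∀ i d → NZ (telescopeFactor i (suc (d +ℕ i)))
    telescopeFactor≉0 i d =
      NZ-* (NZ-resp-≈ (−-congʳ (*-assoc e q _)) (NZ-*ʳ (eq≉0 (suc (d +ℕ i +ℕ i)))))
           (NZ-resp-≈ (reflexive (≡.cong (λ n → 1# − pow q n) (≡.sym (ℕ.m+n∸n≡m (suc d) i))))
                      (NZ-*ʳ (qq≉0 (suc d))))

    baileyInverse-orthogonal : ∀ i m → i < m → sumTo (m ∸ i) (summand i m) ≈ 0#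
    baileyInverse-orthogonal i m i<m = *-≈0⇒≈0 E≉0 (begin
      telescopeFactor i m * sumTo (m ∸ i) (summand i m)
        ≈⟨ telescope i m (m ∸ i) 0 (≡.sym (ℕ.m∸n+n≡m (ℕ.<⇒≤ i<m))) ⟩
      closedForm i m (m ∸ i) 0
        ≈⟨ *-congˡ (-‿inverseʳ 1#) ⟩
      _ * 0#
        ≈⟨ zeroʳ _ ⟩
      0# ∎)
      where
      E≉0 : NZ (telescopeFactor i m)
      E≉0 = ≡.subst (λ n → NZ (telescopeFactor i n))
                    (≡.trans (≡.sym (ℕ.+-suc (m ∸ suc i) i)) (ℕ.m∸n+n≡m i<m))
                    (telescopeFactor≉0 i (m ∸ suc i))

module Reflection {ℓ₁ ℓ₂} (F : Field ℓ₁ ℓ₂) (q a k c e : Field.Carrier F) where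
  open FieldArithmetic F
  open BaileyInverse F q e c using (z; diffProd)
  open import Relation.Binary.Reasoning.Setoid setoid

  w : Carrier
  w = k ÷ a

  reflected : ℕ → Carrier
  reflected N = ((a * q) * pow (q ⁻¹) N) ÷ k

  ratio : Carrier
  ratio = (q * a * c) ÷ (k * e)

  -- ζ and ξ are the factors (−x)^r q^{r(r−1)/2} of the reflection formula
  -- (x;q)_r = (q^{1−r}/x;q)_r (−x)^r q^{r(r−1)/2}, for x = w q^p and x = q^{−r−p} respectively.
  ζ : ℕ → ℕ → Carrier
  ζ zero    p = 1#
  ζ (suc r) p = ζ r p * (- (w * pow q (r +ℕ p)))

  ξ : ℕ → ℕ → Carrier
  ξ zero    p = 1#
  ξ (suc r) p = ξ r p * (- pow (q ⁻¹) (suc (r +ℕ p)))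

  module _ (q≉0 : NZ q) (a≉0 : NZ a) (k≉0 : NZ k) (c≉0 : NZ c) (e≉0 : NZ e) where

    poch-reflect-w : ∀ r p → poch w q (r +ℕ p) ≈ (poch w q p * poch (reflected (r +ℕ p)) q r) * ζ r p
    poch-reflect-w zero    p = sym (trans (*-identityʳ _) (*-identityʳ _))
    poch-reflect-w (suc r) p = begin
      poch w q L * (1# − w * pow q L)
        ≈⟨ *-cong (poch-reflect-w r p) (1−-reflect reflected-inverse) ⟩
      ((poch w q p * poch (reflected L) q r) * ζ r p) * ((1# − reflected (suc L)) * (- (w * pow q L)))
        ≈⟨ solve 5 (λ a b c′ d f → ((a :* b) :* c′) :* (d :* f) := (a :* (d :* b)) :* (c′ :* f)) refl _ _ _ _ _ ⟩
      (poch w q p * ((1# − reflected (suc L)) * poch (reflected L) q r)) * ζ (suc r) p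
        ≈⟨ *-congʳ (*-congˡ (trans (*-congˡ (poch-cong q r (sym reflected-q))) (sym (poch-suc (reflected (suc L)) q r)))) ⟩
      (poch w q p * poch (reflected (suc L)) q (suc r)) * ζ (suc r) p ∎
      where
      L = r +ℕ p
      Q = q ⁻¹
      reflected-inverse : (w * pow q L) * reflected (suc L) ≈ 1#
      reflected-inverse = begin
        (k * a ⁻¹ * pow q L) * (((a * q) * (Q * pow Q L)) * k ⁻¹)
          ≈⟨ solve 8 (λ k a′ qL a q Q QL k′ → (k :* a′ :* qL) :* (((a :* q) :* (Q :* QL)) :* k′)
                                              := ((k :* k′) :* (a :* a′)) :* ((q :* Q) :* (QL :* qL)))
                     refl k (a ⁻¹) (pow q L) a q Q (pow Q L) (k ⁻¹) ⟩
        ((k * k ⁻¹) * (a * a ⁻¹)) * ((q * Q) * (pow Q L * pow q L))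
          ≈⟨ *-cong (*-cong (⁻¹-inverse k k≉0) (⁻¹-inverse a a≉0)) (*-cong (⁻¹-inverse q q≉0) (pow-⁻¹ q≉0 L)) ⟩
        (1# * 1#) * (1# * 1#)
          ≈⟨ trans (*-cong (*-identityˡ 1#) (*-identityˡ 1#)) (*-identityˡ 1#) ⟩
        1# ∎
      reflected-q : reflected (suc L) * q ≈ reflected L
      reflected-q = begin
        (((a * q) * (Q * pow Q L)) * k ⁻¹) * q
          ≈⟨ solve 6 (λ a q Q QL k′ q′ → (((a :* q) :* (Q :* QL)) :* k′) :* q′
                                        := (((a :* q) :* QL) :* k′) :* (Q :* q′))
                     refl a q Q (pow Q L) (k ⁻¹) q ⟩
        (((a * q) * pow Q L) * k ⁻¹) * (Q * q)
          ≈⟨ *-congˡ (⁻¹-inverseˡ q≉0) ⟩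
        (((a * q) * pow Q L) * k ⁻¹) * 1#
          ≈⟨ *-identityʳ _ ⟩
        reflected L ∎

    poch-reflect-q : ∀ r p → poch (pow (q ⁻¹) (r +ℕ p)) q r * poch q q p ≈ poch q q (r +ℕ p) * ξ r p
    poch-reflect-q zero    p = trans (*-identityˡ _) (sym (*-identityʳ _))
    poch-reflect-q (suc r) p = begin
      poch x q (suc r) * poch q q p
        ≈⟨ *-congʳ (poch-suc x q r) ⟩
      ((1# − x) * poch (x * q) q r) * poch q q p
        ≈⟨ *-congʳ (*-congˡ (poch-cong q r x*q≈)) ⟩
      ((1# − x) * poch (pow Q L) q r) * poch q q p
        ≈⟨ *-assoc _ _ _ ⟩
      (1# − x) * (poch (pow Q L) q r * poch q q p)
        ≈⟨ *-cong (1−-reflect (pow-⁻¹ q≉0 (suc L))) (poch-reflect-q r p) ⟩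
      ((1# − pow q (suc L)) * (- x)) * (poch q q L * ξ r p)
        ≈⟨ solve 4 (λ a b c′ d → (a :* b) :* (c′ :* d) := (c′ :* a) :* (d :* b)) refl _ _ _ _ ⟩
      poch q q (suc L) * ξ (suc r) p ∎
      where
      L = r +ℕ p
      Q = q ⁻¹
      x = pow Q (suc L)
      x*q≈ : x * q ≈ pow Q L
      x*q≈ = trans (xy∙z≈y∙xz Q (pow Q L) q) (trans (*-congˡ (⁻¹-inverseˡ q≉0)) (*-identityʳ _))

    reflection-signs : ∀ r p → ((ζ r p * ξ r p) * pow ratio r) * poch (e ÷ c) q r ≈ diffProd r
    reflection-signs zero    p = trans (*-identityʳ _) (trans (*-identityʳ _) (*-identityʳ 1#))
    reflection-signs (suc r) p = begin
      (((ζ r p * (- x)) * (ξ r p * (- y))) * (ratio * pow ratio r)) * (poch (e ÷ c) q r * (1# − u))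
        ≈⟨ solve 8 (λ ζ x ξ y X Xr E o → (((ζ :* (:- x)) :* (ξ :* (:- y))) :* (X :* Xr)) :* (E :* o)
                                          := (((ζ :* ξ) :* Xr) :* E) :* (((x :* y) :* X) :* o))
                   refl (ζ r p) x (ξ r p) y ratio (pow ratio r) (poch (e ÷ c) q r) (1# − u) ⟩
      (((ζ r p * ξ r p) * pow ratio r) * poch (e ÷ c) q r) * (((x * y) * ratio) * (1# − u))
        ≈⟨ *-cong (reflection-signs r p) (*-congʳ xy-ratio) ⟩
      diffProd r * (z * (1# − u))
        ≈⟨ *-congˡ z[1−u] ⟩
      diffProd r * (z − pow q r) ∎
      where
      L = r +ℕ p
      Q = q ⁻¹
      x = w * pow q L
      y = pow Q (suc L)
      u = (e ÷ c) * pow q r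
      xy-ratio : (x * y) * ratio ≈ z
      xy-ratio = begin
        ((k * a ⁻¹ * pow q L) * (Q * pow Q L)) * ((q * a * c) * (k * e) ⁻¹)
          ≈⟨ *-congˡ (*-congˡ (⁻¹-distrib-* k≉0 e≉0)) ⟩
        ((k * a ⁻¹ * pow q L) * (Q * pow Q L)) * ((q * a * c) * (k ⁻¹ * e ⁻¹))
          ≈⟨ solve 10 (λ k a′ qL Q QL q a c k′ e′ →
                         ((k :* a′ :* qL) :* (Q :* QL)) :* ((q :* a :* c) :* (k′ :* e′))
                         := (((k :* k′) :* (a :* a′)) :* ((q :* Q) :* (QL :* qL))) :* (c :* e′))
                     refl k (a ⁻¹) (pow q L) Q (pow Q L) q a c (k ⁻¹) (e ⁻¹) ⟩
        (((k * k ⁻¹) * (a * a ⁻¹)) * ((q * Q) * (pow Q L * pow q L))) * z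
          ≈⟨ *-congʳ (*-cong (*-cong (⁻¹-inverse k k≉0) (⁻¹-inverse a a≉0))
                             (*-cong (⁻¹-inverse q q≉0) (pow-⁻¹ q≉0 L))) ⟩
        ((1# * 1#) * (1# * 1#)) * z
          ≈⟨ trans (*-congʳ (trans (*-cong (*-identityˡ 1#) (*-identityˡ 1#)) (*-identityˡ 1#))) (*-identityˡ z) ⟩
        z ∎
      z[1−u] : z * (1# − u) ≈ z − pow q r
      z[1−u] = begin
        (c * e ⁻¹) * (1# − (e * c ⁻¹) * pow q r)
          ≈⟨ solve 5 (λ c e′ e c′ qr → (c :* e′) :* (:1 :- (e :* c′) :* qr)
                                       := (c :* e′) :- ((c :* c′) :* (e :* e′)) :* qr)
                     refl c (e ⁻¹) e (c ⁻¹) (pow q r) ⟩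
        z − ((c * c ⁻¹) * (e * e ⁻¹)) * pow q r
          ≈⟨ −-congʳ (trans (*-congʳ (trans (*-cong (⁻¹-inverse c c≉0) (⁻¹-inverse e e≉0)) (*-identityˡ 1#)))
                            (*-identityˡ _)) ⟩
        z − pow q r ∎

    reflection : ∀ r p → let N = r +ℕ p in
      (((poch w q N * poch (pow (q ⁻¹) N) q r) * poch q q p) * pow ratio r) * poch (e ÷ c) q r
        ≈ ((poch w q p * poch (reflected N) q r) * poch q q N) * diffProd r
    reflection r p = begin
      (((poch w q N * poch (pow (q ⁻¹) N) q r) * poch q q p) * pow ratio r) * poch (e ÷ c) q r
        ≈⟨ solve 5 (λ W R Q X E → (((W :* R) :* Q) :* X) :* E := (W :* (R :* Q)) :* (X :* E)) refl _ _ _ _ _ ⟩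
      (poch w q N * (poch (pow (q ⁻¹) N) q r * poch q q p)) * (pow ratio r * poch (e ÷ c) q r)
        ≈⟨ *-congʳ (*-cong (poch-reflect-w r p) (poch-reflect-q r p)) ⟩
      (((poch w q p * poch (reflected N) q r) * ζ r p) * (poch q q N * ξ r p)) * (pow ratio r * poch (e ÷ c) q r)
        ≈⟨ solve 7 (λ W Y Z Q Ξ X E → (((W :* Y) :* Z) :* (Q :* Ξ)) :* (X :* E)
                                      := ((W :* Y) :* Q) :* (((Z :* Ξ) :* X) :* E))
                   refl _ _ _ _ _ _ _ ⟩
      ((poch w q p * poch (reflected N) q r) * poch q q N) * (((ζ r p * ξ r p) * pow ratio r) * poch (e ÷ c) q r)
        ≈⟨ *-congˡ (reflection-signs r p) ⟩
      ((poch w q p * poch (reflected N) q r) * poch q q N) * diffProd r ∎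
      where N = r +ℕ p

index-L+r : ∀ n j r → n +ℕ j +ℕ r ≡ n +ℕ (r +ℕ j)
index-L+r = solve-∀

index-2m : ∀ j r → 2 *ℕ j +ℕ 2 *ℕ r ≡ 2 *ℕ (r +ℕ j)
index-2m = solve-∀

index-m+j : ∀ j r → 2 *ℕ j +ℕ r ≡ r +ℕ j +ℕ j
index-m+j = solve-∀

module Factorisation {ℓ₁ ℓ₂} (F : Field ℓ₁ ℓ₂) (q a k c e : Field.Carrier F) where
  open FieldArithmetic F
  open FiniteSums F using (sumTo-cong′; sumTo-*ˡ)
  open BaileyInverse F q e c using (diffProd; baileyInverse)
  open Reflection F q a k c e
  open import Relation.Binary.Reasoning.Setoid setoid

  -- The two fractions of the (j, r) summand of beta', as functions of N = n − j and L = n + j.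
  outerWeight : ℕ → ℕ → ℕ → Carrier
  outerWeight N L j =
    ((((1# − c * pow q (2 *ℕ j)) * poch w q N) * poch k q L) * poch (e * q) q (2 *ℕ j))
      ÷ ((((1# − c) * poch q q N) * poch (a * q) q L) * poch (c * q) q (2 *ℕ j))

  innerWeight : ℕ → ℕ → ℕ → ℕ → Carrier
  innerWeight N L j r =
    (((((1# − e * pow q (2 *ℕ j +ℕ 2 *ℕ r)) * poch (pow (q ⁻¹) N) q r) * poch (k * pow q L) q r)
       * poch (e ÷ c) q r) * poch (e * pow q (2 *ℕ j)) q r)
      ÷ (((((1# − e * pow q (2 *ℕ j)) * poch (a * pow q (suc L)) q r) * poch (reflected N) q r)
          * poch (c * pow q (suc (2 *ℕ j))) q r) * poch q q r)

  -- coef q a k n m and baileyInverse m j with their indices n − m, n + m and 2m, m + j, m − j made free.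
  coefAt : ℕ → ℕ → Carrier
  coefAt d s = (poch w q d * poch k q s) ÷ (poch q q d * poch (a * q) q s)

  inverseAt : ℕ → ℕ → ℕ → ℕ → Carrier
  inverseAt j t u v =
    ((((1# − c * pow q (2 *ℕ j)) * (1# − e * pow q t)) * poch e q u) * diffProd v)
      ÷ ((((1# − c) * (1# − e)) * poch (c * q) q u) * poch q q v)

  module _ (q≉0 : NZ q) (a≉0 : NZ a) (k≉0 : NZ k) (c≉0 : NZ c) (e≉0 : NZ e)
           (1-c≉0 : NZ (1# − c)) (1-e≉0 : NZ (1# − e)) (qq≉0 : ∀ n → NZ (poch q q n))
           (aq≉0 : ∀ n → NZ (poch (a * q) q n)) (cq≉0 : ∀ n → NZ (poch (c * q) q n))
           (1-eq²ʲ≉0 : ∀ j → NZ (1# − e * pow q (2 *ℕ j))) where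

    factorisation-core : ∀ L j r p → let N = r +ℕ p in
      NZ (poch (a * pow q (suc L)) q r) → NZ (poch (reflected N) q r) → NZ (poch (c * pow q (suc (2 *ℕ j))) q r) →
      outerWeight N L j * (innerWeight N L j r * pow ratio r)
        ≈ coefAt p (L +ℕ r) * inverseAt j (2 *ℕ j +ℕ 2 *ℕ r) (2 *ℕ j +ℕ r) r
    factorisation-core L j r p ar≉0 yr≉0 cr≉0 = begin
      (nW ÷ dW) * ((nT ÷ dT) * pow ratio r)
        ≈⟨ *-congˡ (÷-*ʳ nT dT (pow ratio r)) ⟩
      (nW ÷ dW) * ((nT * pow ratio r) ÷ dT)
        ≈⟨ ÷-*-÷ dW≉0 dT≉0 ⟩
      (nW * (nT * pow ratio r)) ÷ (dW * dT)
        ≈⟨ ÷-cross (NZ-* dW≉0 dT≉0) (NZ-* dC≉0 dP≉0) cross ⟩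
      (nC * nP) ÷ (dC * dP)
        ≈⟨ ÷-*-÷ dC≉0 dP≉0 ⟨
      (nC ÷ dC) * (nP ÷ dP) ∎
      where
      N = r +ℕ p
      j₂ = 2 *ℕ j
      A1 = 1# − c * pow q j₂
      A2 = 1# − e * pow q (j₂ +ℕ 2 *ℕ r)
      A3 = 1# − e * pow q j₂
      nW = ((A1 * poch w q N) * poch k q L) * poch (e * q) q j₂
      dW = (((1# − c) * poch q q N) * poch (a * q) q L) * poch (c * q) q j₂
      nT = (((A2 * poch (pow (q ⁻¹) N) q r) * poch (k * pow q L) q r) * poch (e ÷ c) q r) * poch (e * pow q j₂) q r
      dT = (((A3 * poch (a * pow q (suc L)) q r) * poch (reflected N) q r) * poch (c * pow q (suc j₂)) q r) * poch q q r
      nC = poch w q p * poch k q (L +ℕ r)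
      dC = poch q q p * poch (a * q) q (L +ℕ r)
      nP = ((A1 * A2) * poch e q (j₂ +ℕ r)) * diffProd r
      dP = (((1# − c) * (1# − e)) * poch (c * q) q (j₂ +ℕ r)) * poch q q r
      dW≉0 = NZ-* (NZ-* (NZ-* 1-c≉0 (qq≉0 N)) (aq≉0 L)) (cq≉0 j₂)
      dT≉0 = NZ-* (NZ-* (NZ-* (NZ-* (1-eq²ʲ≉0 j) ar≉0) yr≉0) cr≉0) (qq≉0 r)
      dC≉0 = NZ-* (qq≉0 p) (aq≉0 (L +ℕ r))
      dP≉0 = NZ-* (NZ-* (NZ-* 1-c≉0 1-e≉0) (cq≉0 (j₂ +ℕ r))) (qq≉0 r)
      e-factors : ((1# − e) * poch (e * q) q j₂) * poch (e * pow q j₂) q r ≈ A3 * poch e q (j₂ +ℕ r)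
      e-factors = begin
        ((1# − e) * poch (e * q) q j₂) * poch (e * pow q j₂) q r  ≈⟨ *-congʳ (poch-suc e q j₂) ⟨
        (poch e q j₂ * A3) * poch (e * pow q j₂) q r              ≈⟨ xy∙z≈y∙xz _ A3 _ ⟩
        A3 * (poch e q j₂ * poch (e * pow q j₂) q r)              ≈⟨ *-congˡ (poch-+ e q j₂ r) ⟨
        A3 * poch e q (j₂ +ℕ r)                                   ∎
      cross : (nW * (nT * pow ratio r)) * (dC * dP) ≈ (nC * nP) * (dW * dT)
      cross = begin
        (nW * (nT * pow ratio r)) * (dC * dP)
          ≈⟨ solve 16 (λ a₁ wN kL eq a₂ QN kL′ ec eq′ X qp aL′ oc oe cm qr →
               ((((a₁ :* wN) :* kL) :* eq) :* ((((((a₂ :* QN) :* kL′) :* ec) :* eq′)) :* X))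
                 :* ((qp :* aL′) :* (((oc :* oe) :* cm) :* qr))
               := (((((((a₁ :* a₂) :* oc) :* qr) :* (kL :* kL′)) :* ((((wN :* QN) :* qp) :* X) :* ec))
                     :* ((oe :* eq) :* eq′)) :* aL′) :* cm)
               refl _ _ _ _ _ _ _ _ _ _ _ _ _ _ _ _ ⟩
        (((((((A1 * A2) * (1# − c)) * poch q q r) * (poch k q L * poch (k * pow q L) q r))
            * ((((poch w q N * poch (pow (q ⁻¹) N) q r) * poch q q p) * pow ratio r) * poch (e ÷ c) q r))
            * (((1# − e) * poch (e * q) q j₂) * poch (e * pow q j₂) q r))
            * poch (a * q) q (L +ℕ r)) * poch (c * q) q (j₂ +ℕ r)
          ≈⟨ *-cong (*-cong (*-cong (*-cong (*-congˡ (sym (poch-+ k q L r))) (reflection q≉0 a≉0 k≉0 c≉0 e≉0 r p))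
                                    e-factors)
                            (poch-+-shift a q L r))
                    (poch-+-shift c q j₂ r) ⟩
        (((((((A1 * A2) * (1# − c)) * poch q q r) * poch k q (L +ℕ r))
            * (((poch w q p * poch (reflected N) q r) * poch q q N) * diffProd r))
            * (A3 * poch e q (j₂ +ℕ r)))
            * (poch (a * q) q L * poch (a * pow q (suc L)) q r))
            * (poch (c * q) q j₂ * poch (c * pow q (suc j₂)) q r)
          ≈⟨ solve 15 (λ a₁ a₂ oc qr kL′ wp yr qN π a₃ em aL ar cq cr →
               (((((((a₁ :* a₂) :* oc) :* qr) :* kL′) :* (((wp :* yr) :* qN) :* π)) :* (a₃ :* em))
                 :* (aL :* ar)) :* (cq :* cr)
               := ((wp :* kL′) :* (((a₁ :* a₂) :* em) :* π))
                  :* ((((oc :* qN) :* aL) :* cq) :* ((((a₃ :* ar) :* yr) :* cr) :* qr)))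
               refl _ _ _ _ _ _ _ _ _ _ _ _ _ _ _ ⟩
        (nC * nP) * (dW * dT) ∎

    factorisation : ∀ n j r → r ≤ n ∸ j →
      NZ (poch (a * pow q (suc (n +ℕ j))) q r) × NZ (poch (reflected (n ∸ j)) q r)
        × NZ (poch (c * pow q (suc (2 *ℕ j))) q r) →
      outerWeight (n ∸ j) (n +ℕ j) j * (innerWeight (n ∸ j) (n +ℕ j) j r * pow ratio r)
        ≈ coef q a k n (r +ℕ j) * baileyInverse (r +ℕ j) j
    factorisation n j r r≤N (ar≉0 , yr≉0 , cr≉0) = begin
      outerWeight (n ∸ j) L j * (innerWeight (n ∸ j) L j r * pow ratio r)
        ≡⟨ ≡.cong (λ N → outerWeight N L j * (innerWeight N L j r * pow ratio r)) N≡r+p ⟩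
      outerWeight (r +ℕ p) L j * (innerWeight (r +ℕ p) L j r * pow ratio r)
        ≈⟨ factorisation-core L j r p ar≉0 (≡.subst (λ N → NZ (poch (reflected N) q r)) N≡r+p yr≉0) cr≉0 ⟩
      coefAt p (L +ℕ r) * inverseAt j (2 *ℕ j +ℕ 2 *ℕ r) (2 *ℕ j +ℕ r) r
        ≡⟨ cast (≡.trans (ℕ.∸-+-assoc n j r) (≡.cong (n ∸_) (ℕ.+-comm j r))) (index-L+r n j r)
                (index-2m j r) (index-m+j j r) (≡.sym (ℕ.m+n∸n≡m r j)) ⟩
      coef q a k n (r +ℕ j) * baileyInverse (r +ℕ j) j ∎
      where
      L = n +ℕ j
      p = n ∸ j ∸ r
      N≡r+p : n ∸ j ≡ r +ℕ p
      N≡r+p = ≡.sym (ℕ.m+[n∸m]≡n r≤N)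
      cast : ∀ {d d′ s s′ t t′ u u′ v v′} → d ≡ d′ → s ≡ s′ → t ≡ t′ → u ≡ u′ → v ≡ v′ →
             coefAt d s * inverseAt j t u v ≡ coefAt d′ s′ * inverseAt j t′ u′ v′
      cast ≡.refl ≡.refl ≡.refl ≡.refl ≡.refl = ≡.refl

  beta'-regroup : ∀ g (β : ℕ → Carrier) n →
    beta' F q a k c e g β n
      ≈ sumTo n (λ j → β j * sumTo (n ∸ j) (λ r →
          (outerWeight (n ∸ j) (n +ℕ j) j * (innerWeight (n ∸ j) (n +ℕ j) j r * pow ratio r)) * g (r +ℕ j)))
  beta'-regroup g β n = sumTo-cong′ n (λ j → trans (*-assoc (β j) _ _)
    (*-congˡ (trans (sumTo-*ˡ (n ∸ j) _ _) (sumTo-cong′ (n ∸ j) (λ r →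
      trans (*-congˡ (sym (*-assoc _ (pow ratio r) _))) (sym (*-assoc _ _ (g (r +ℕ j)))))))))

theorem2p4 : ∀ {ℓ₁ ℓ₂ : Level} (F : Field ℓ₁ ℓ₂) (q : Field.Carrier F)
    → (α β : Field.Carrier F → Field.Carrier F → ℕ → Field.Carrier F)
    → (∀ a k → BaseGeneric F q a k → PairRel F q a k (α a k) (β a k))
    → (g : ℕ → Field.Carrier F) (c e : Field.Carrier F)
    → BaseGeneric F q e c
    → (a k : Field.Carrier F)
    → BaseGeneric F q a k
    → ExtraGeneric F q a k c e
    → PairRel F q a k (alpha' F g (α e c)) (beta' F q a k c e g (β e c))
theorem2p4 F q α β pair g c e ec-generic@(e≉0 , qq≉0 , eq≉0) a k (a≉0 , _ , aq≉0)
           (q≉0 , k≉0 , _ , c≉0 , 1-c≉0 , cq≉0 , 1-eq²ʲ≉0 , inner≉0) n = begin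
  beta' F q a k c e g (β e c) n
    ≈⟨ beta'-regroup g (β e c) n ⟩
  sumTo n (λ j → β e c j * sumTo (n ∸ j) (W j))
    ≈⟨ bailey-transform n baileyInverse (coef q e c) (α e c) (β e c) C W
         (baileyInverse-diagonal e≉0 1-c≉0 1-e≉0 qq≉0 cq≉0 eq≉0)
         (baileyInverse-orthogonal e≉0 1-c≉0 1-e≉0 qq≉0 cq≉0 eq≉0)
         (pair e c ec-generic) W≈PC ⟩
  sumTo n (λ m → C m * α e c m)
    ≈⟨ sumTo-cong′ n (λ m → *-assoc _ _ _) ⟩
  sumTo n (λ m → coef q a k n m * (g m * α e c m)) ∎
  where
  open FieldArithmetic F
  open FiniteSums F
  open BaileyInverse F q e c
  open Reflection F q a k c e using (ratio)
  open Factorisation F q a k c e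
  open import Relation.Binary.Reasoning.Setoid setoid

  1-e≉0 : NZ (1# − e)
  1-e≉0 = NZ-resp-≈ (−-congʳ (*-identityʳ e)) (1-eq²ʲ≉0 0)

  C : ℕ → Carrier
  C m = coef q a k n m * g m

  W : ℕ → ℕ → Carrier
  W j r = (outerWeight (n ∸ j) (n +ℕ j) j * (innerWeight (n ∸ j) (n +ℕ j) j r * pow ratio r)) * g (r +ℕ j)

  W≈PC : ∀ j r → j ≤ n → r ≤ n ∸ j → W j r ≈ baileyInverse (r +ℕ j) j * C (r +ℕ j)
  W≈PC j r j≤n r≤n∸j =
    trans (*-congʳ (factorisation q≉0 a≉0 k≉0 c≉0 e≉0 1-c≉0 1-e≉0 qq≉0 aq≉0 cq≉0 1-eq²ʲ≉0
                                  n j r r≤n∸j (inner≉0 n j r j≤n r≤n∸j)))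
          (xy∙z≈y∙xz _ _ _)
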